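{- Let $t\in\mathbb{N}$, let $\mathcal{C}$ be a class of graphs none of which contains $K_{t,t}$ as a subgraph, and let $r\in\mathbb{N}\cup\{\infty\}$ (with $3\cdot\infty=\infty$). Then: (A) if $\mathcal{C}$ is $3r$-flip-breakable, then $\mathcal{C}$ is $r$-deletion-breakable; (B) if $\mathcal{C}$ is $3r$-flip-separable, then $\mathcal{C}$ is $r$-deletion-separable; (C) if $\mathcal{C}$ is $3r$-flip-flat, then $\mathcal{C}$ is $r$-deletion-flat; (D) if $\mathcal{C}$ has bounded $3r$-flipper-rank, then $\mathcal{C}$ has bounded $r$-splitter-rank.
   Context: Graphs are finite, simple, undirected; distances are shortest-path distances ($\infty$ if disconnected); $B^r_H(v)$ is the set of vertices at distance at most $r$ from $v$ in $H$, and $H[X]$ is the induced subgraph. For $A,B\subseteq V(G)$, flipping $(A,B)$ yields the graph on $V(G)$ with edge set (on distinct pairs) $E(G)\triangle\{ab:a\in A,b\in B\}$. A $k$-flip of $G$ is a graph obtained from $G$ by flipping some pairs $(A,B)$ with $A,B\in\mathcal{P}$ (possibly $A=B$) for some partition $\mathcal{P}$ of $V(G)$ with $|\mathcal{P}|\le k$. A $k$-deletion of $G$ is a graph obtained from $G$ by deleting at most $k$ vertices. For $r\in\mathbb{N}\cup\{\infty\}$: $\mathcal{C}$ is $r$-flip-flat if there are a function $M:\mathbb{N}\to\mathbb{N}$ and $k\in\mathbb{N}$ such that for every $G\in\mathcal{C}$, every $m$ and every $W\subseteq V(G)$ with $|W|\ge M(m)$ there are a $k$-flip $H$ of $G$ and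 $A\subseteq W$ with $|A|=m$ such that $\operatorname{dist}_H(u,v)>r$ for all distinct $u,v\in A$. $\mathcal{C}$ is $r$-flip-breakable if there are $M$ and $k$ such that for every $G\in\mathcal{C}$, $m$, and $W\subseteq V(G)$ with $|W|\ge M(m)$ there are a $k$-flip $H$ of $G$ and disjoint $A,B\subseteq W$ with $|A|=|B|=m$ such that $\operatorname{dist}_H(u,v)>r$ for all $u\in A$, $v\in B$. $\mathcal{C}$ is $r$-flip-separable if there is $k$ such that for every $G\in\mathcal{C}$ and every $W\subseteq V(G)$ there is a $k$-flip $H$ of $G$ with $|B^r_H(v)\cap W|\le\lceil |W|/2\rceil$ for every vertex $v$. The notions $r$-deletion-flat, $r$-deletion-breakable, $r$-deletion-separable are defined identically with "$k$-flip" replaced by "$k$-deletion" (the distance and ball conditions then refer to vertices of $H$). Flipper-rank: for $r\in\mathbb{N}\cup\{\infty\}$, $k\in\mathbb{N}$, set $\mathrm{frk}_{r,k}(K_1)=1$ and for every other graph $G$, $\mathrm{frk}_{r,k}(G)=1+\min_{H}\max_{v\in V(H)}\mathrm{frk}_{r,k}(H[B^r_H(v)])$, the minimum over all $k$-flips $H$ of $G$. Splitter-rank $\mathrm{srk}_{r,k}$ is defined identically with $k$-flip replaced by $k$-deletion. $\mathcal{C}$ has bounded $r$-flipper-rank (resp. $r$-splitter-rank) if there are $k,\ell\in\mathbb{N}$ with $\mathrm{frk}_{r,k}(G)\le\ell$ (resp. $\mathrm{srk}_{r,k}(G)\le\ell$) for all $G\in\mathcal{C}$. -}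

module Defs where

open import Data.Nat using (ℕ; zero; suc; _≤_; _*_; ⌈_/2⌉)
open import Data.Bool using (Bool; true; false; if_then_else_; _xor_)
open import Data.Fin using (Fin; zero; suc; _≟_)
open import Data.Fin.Subset using (Subset; ∣_∣; _∈_; _⊆_; _∩_; ∁)
open import Data.Vec using (Vec; []; _∷_; tabulate; lookup)
open import Data.Product using (Σ; Σ-syntax; ∃; ∃-syntax; _×_; _,_)
open import Data.Sum using (_⊎_)
open import Data.Empty using (⊥; ⊥-elim)
open import Data.Unit using (⊤)
open import Relation.Nullary using (¬_; yes; no; does)
open import Relation.Binary.PropositionalEquality using (_≡_; _≢_; refl)

record Graph : Set where
  field
    n     : ℕ
    adj   : Fin n → Fin n → Bool
    sym   : ∀ u v → adj u v ≡ adj v u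
    irr   : ∀ v → adj v v ≡ false

open Graph public

data ℕ∞ : Set where
  fin : ℕ → ℕ∞
  ∞   : ℕ∞

3×_ : ℕ∞ → ℕ∞
3× fin r = fin (3 * r)
3× ∞     = ∞

_≤∞_ : ℕ → ℕ∞ → Set
ℓ ≤∞ fin r = ℓ ≤ r
ℓ ≤∞ ∞     = ⊤

data Walk (G : Graph) : Fin (n G) → Fin (n G) → ℕ → Set where
  [] : ∀ {u} → Walk G u u 0
  _∷_ : ∀ {u w v ℓ} → adj G u w ≡ true → Walk G w v ℓ → Walk G u v (suc ℓ)

Within : (G : Graph) → ℕ∞ → Fin (n G) → Fin (n G) → Set
Within G r u v = ∃[ ℓ ] (ℓ ≤∞ r × Walk G u v ℓ)

Far : (G : Graph) → ℕ∞ → Fin (n G) → Fin (n G) → Set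
Far G r u v = ¬ Within G r u v

IsBall : (G : Graph) → ℕ∞ → Fin (n G) → Subset (n G) → Set
IsBall G r v X = ∀ u → (u ∈ X → Within G r v u) × (Within G r v u → u ∈ X)

emb : ∀ {m} (X : Subset m) → Fin ∣ X ∣ → Fin m
emb (true ∷ X) zero = zero
emb (true ∷ X) (suc i) = suc (emb X i)
emb (false ∷ X) i = suc (emb X i)

induced : (G : Graph) → Subset (n G) → Graph
induced G X = record
  { n = ∣ X ∣
  ; adj = λ i j → adj G (emb X i) (emb X j)
  ; sym = λ i j → sym G (emb X i) (emb X j)
  ; irr = λ i → irr G (emb X i)
  }

pull : ∀ {a m} → (Fin a → Fin m) → Subset m → Subset a
pull e W = tabulate (λ i → lookup W (e i))

-- Flips.  A partition P with |P| ≤ k is given by part : V → Fin k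
-- (parts = nonempty fibres); the set of flipped pairs (A,B) by F.

toggle : ∀ {k} → (Fin k → Fin k → Bool) → Fin k → Fin k → Bool
toggle F i j with i ≟ j
... | yes _ = F i i
... | no _ = F i j xor F j i

xor-comm′ : ∀ a b → a xor b ≡ b xor a
xor-comm′ true true = refl
xor-comm′ true false = refl
xor-comm′ false true = refl
xor-comm′ false false = refl

toggle-sym : ∀ {k} (F : Fin k → Fin k → Bool) i j → toggle F i j ≡ toggle F j i
toggle-sym F i j with i ≟ j | j ≟ i
... | yes refl | yes _ = refl
... | yes refl | no ne = ⊥-elim (ne refl)
... | no ne | yes refl = ⊥-elim (ne refl)
... | no _ | no _ = xor-comm′ (F i j) (F j i)

flipAdj : (G : Graph) {k : ℕ} → (Fin (n G) → Fin k) → (Fin k → Fin k → Bool)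
        → Fin (n G) → Fin (n G) → Bool
flipAdj G part F u v with u ≟ v
... | yes _ = false
... | no _ = adj G u v xor toggle F (part u) (part v)

flipAdj-sym : (G : Graph) {k : ℕ} (part : Fin (n G) → Fin k) (F : Fin k → Fin k → Bool)
            → ∀ u v → flipAdj G part F u v ≡ flipAdj G part F v u
flipAdj-sym G part F u v with u ≟ v | v ≟ u
... | yes _ | yes _ = refl
... | yes refl | no ne = ⊥-elim (ne refl)
... | no ne | yes refl = ⊥-elim (ne refl)
... | no _ | no _ with sym G u v | toggle-sym F (part u) (part v)
...   | e1 | e2 rewrite e1 | e2 = refl

flipAdj-irr : (G : Graph) {k : ℕ} (part : Fin (n G) → Fin k) (F : Fin k → Fin k → Bool)
            → ∀ v → flipAdj G part F v v ≡ false
flipAdj-irr G part F v with v ≟ v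
... | yes _ = refl
... | no ne = ⊥-elim (ne refl)

flipG : (G : Graph) {k : ℕ} → (Fin (n G) → Fin k) → (Fin k → Fin k → Bool) → Graph
flipG G part F = record
  { n = n G
  ; adj = flipAdj G part F
  ; sym = flipAdj-sym G part F
  ; irr = flipAdj-irr G part F
  }

delete : (G : Graph) → Subset (n G) → Graph
delete G S = induced G (∁ S)

Class : Set₁
Class = Graph → Set

ContainsKtt : ℕ → Graph → Set
ContainsKtt t G =
  Σ[ a ∈ (Fin t → Fin (n G)) ] Σ[ b ∈ (Fin t → Fin (n G)) ]
    (∀ i j → a i ≡ a j → i ≡ j) × (∀ i j → b i ≡ b j → i ≡ j) ×
    (∀ i j → a i ≢ b j) × (∀ i j → adj G (a i) (b j) ≡ true)

Disjoint : ∀ {m} → Subset m → Subset m → Set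
Disjoint A B = ∀ x → x ∈ A → x ∈ B → ⊥

FlipFlat : ℕ∞ → Class → Set
FlipFlat r C =
  Σ[ M ∈ (ℕ → ℕ) ] Σ[ k ∈ ℕ ] ∀ (G : Graph) → C G → ∀ (m : ℕ) (W : Subset (n G)) →
    M m ≤ ∣ W ∣ →
    Σ[ part ∈ (Fin (n G) → Fin k) ] Σ[ F ∈ (Fin k → Fin k → Bool) ]
    Σ[ A ∈ Subset (n G) ] A ⊆ W × ∣ A ∣ ≡ m ×
      (∀ u v → u ∈ A → v ∈ A → u ≢ v → Far (flipG G part F) r u v)

FlipBreakable : ℕ∞ → Class → Set
FlipBreakable r C =
  Σ[ M ∈ (ℕ → ℕ) ] Σ[ k ∈ ℕ ] ∀ (G : Graph) → C G → ∀ (m : ℕ) (W : Subset (n G)) →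
    M m ≤ ∣ W ∣ →
    Σ[ part ∈ (Fin (n G) → Fin k) ] Σ[ F ∈ (Fin k → Fin k → Bool) ]
    Σ[ A ∈ Subset (n G) ] Σ[ B ∈ Subset (n G) ]
      A ⊆ W × B ⊆ W × Disjoint A B × ∣ A ∣ ≡ m × ∣ B ∣ ≡ m ×
      (∀ u v → u ∈ A → v ∈ B → Far (flipG G part F) r u v)

FlipSeparable : ℕ∞ → Class → Set
FlipSeparable r C =
  Σ[ k ∈ ℕ ] ∀ (G : Graph) → C G → ∀ (W : Subset (n G)) →
    Σ[ part ∈ (Fin (n G) → Fin k) ] Σ[ F ∈ (Fin k → Fin k → Bool) ]
      (∀ v X → IsBall (flipG G part F) r v X → ∣ X ∩ W ∣ ≤ ⌈ ∣ W ∣ /2⌉)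

DeletionFlat : ℕ∞ → Class → Set
DeletionFlat r C =
  Σ[ M ∈ (ℕ → ℕ) ] Σ[ k ∈ ℕ ] ∀ (G : Graph) → C G → ∀ (m : ℕ) (W : Subset (n G)) →
    M m ≤ ∣ W ∣ →
    Σ[ S ∈ Subset (n G) ] ∣ S ∣ ≤ k ×
    Σ[ A ∈ Subset (n (delete G S)) ] (∀ i → i ∈ A → emb (∁ S) i ∈ W) × ∣ A ∣ ≡ m ×
      (∀ u v → u ∈ A → v ∈ A → u ≢ v → Far (delete G S) r u v)

DeletionBreakable : ℕ∞ → Class → Set
DeletionBreakable r C =
  Σ[ M ∈ (ℕ → ℕ) ] Σ[ k ∈ ℕ ] ∀ (G : Graph) → C G → ∀ (m : ℕ) (W : Subset (n G)) →
    M m ≤ ∣ W ∣ →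
    Σ[ S ∈ Subset (n G) ] ∣ S ∣ ≤ k ×
    Σ[ A ∈ Subset (n (delete G S)) ] Σ[ B ∈ Subset (n (delete G S)) ]
      (∀ i → i ∈ A → emb (∁ S) i ∈ W) × (∀ i → i ∈ B → emb (∁ S) i ∈ W) ×
      Disjoint A B × ∣ A ∣ ≡ m × ∣ B ∣ ≡ m ×
      (∀ u v → u ∈ A → v ∈ B → Far (delete G S) r u v)

DeletionSeparable : ℕ∞ → Class → Set
DeletionSeparable r C =
  Σ[ k ∈ ℕ ] ∀ (G : Graph) → C G → ∀ (W : Subset (n G)) →
    Σ[ S ∈ Subset (n G) ] ∣ S ∣ ≤ k ×
      (∀ v X → IsBall (delete G S) r v X →
         ∣ X ∩ pull (emb (∁ S)) W ∣ ≤ ⌈ ∣ W ∣ /2⌉)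

-- Ranks:  FrkLe r k ℓ G  means  frk_{r,k}(G) ≤ ℓ

FrkLe : ℕ∞ → ℕ → ℕ → Graph → Set
FrkLe r k zero G = ⊥
FrkLe r k (suc ℓ) G =
  (n G ≡ 1) ⊎
  (Σ[ part ∈ (Fin (n G) → Fin k) ] Σ[ F ∈ (Fin k → Fin k → Bool) ]
     (∀ v X → IsBall (flipG G part F) r v X → FrkLe r k ℓ (induced (flipG G part F) X)))

SrkLe : ℕ∞ → ℕ → ℕ → Graph → Set
SrkLe r k zero G = ⊥
SrkLe r k (suc ℓ) G =
  (n G ≡ 1) ⊎
  (Σ[ S ∈ Subset (n G) ] ∣ S ∣ ≤ k ×
     (∀ v X → IsBall (delete G S) r v X → SrkLe r k ℓ (induced (delete G S) X)))

BoundedFlipperRank : ℕ∞ → Class → Set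
BoundedFlipperRank r C = Σ[ k ∈ ℕ ] Σ[ ℓ ∈ ℕ ] (∀ G → C G → FrkLe r k ℓ G)

BoundedSplitterRank : ℕ∞ → Class → Set
BoundedSplitterRank r C = Σ[ k ∈ ℕ ] Σ[ ℓ ∈ ℕ ] (∀ G → C G → SrkLe r k ℓ G)

-- Let H be a k-flip of a K_{t,t}-free graph G. Delete every part of size below N =
-- t(2t+3), and from every larger part Q the vertices with at most 2t non-neighbours in Q;
-- by K_{t,t}-freeness there are fewer than t of them, so the deleted set S has at most kN
-- vertices. An edge uv of G - S between unflipped parts is an edge of H. Between flipped
-- parts, u has 2t+1 non-neighbours in the part of v and v in the part of u, and
-- K_{t,t}-freeness gives a non-adjacent pair y, z among them, so u y z v is a path of H.
-- Hence distances in H are at most three times those in G - S, which turns the flip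
-- properties at radius 3r into the deletion properties at radius r. For the ranks, a ball
-- of G - S lies inside the corresponding 3r-ball of H, on which G is again a flip of H, so
-- the recursion goes on with k^2 parts.

module Submission where

open import Defs
open import Data.Nat using (ℕ)
open import Data.Product using (_×_)
open import Relation.Nullary using (¬_)

open import Data.Nat using (zero; suc; _+_; _*_; _≤_; _<_; z≤n; s≤s; _<?_; _≤?_; ⌈_/2⌉)
open import Data.Nat.Properties
  using (module ≤-Reasoning; ≤-refl; ≤-trans; ≤-reflexive; ≤-antisym; ≤-total; <-irrefl; <⇒≤; ≤⇒≯;
         ≰⇒>; ≮⇒≥; n≤1+n; m≤m+n; m≤n+m;
         +-comm; +-suc; +-mono-≤; +-monoʳ-≤; +-cancelʳ-≤; *-comm; *-monoʳ-≤; *-identityʳ)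
open import Data.Bool using (Bool; true; false; not; _xor_)
open import Data.Bool.Properties using (T-≡; ¬-not; not-involutive; xor-assoc; xor-same; xor-identityʳ)
  renaming (_≟_ to _≟ᵇ_)
open import Data.Fin using (Fin; zero; suc; _≟_; toℕ; fromℕ<; inject≤; combine; remQuot)
open import Data.Fin.Properties
  using (any?; toℕ-injective; toℕ-fromℕ<; toℕ-inject≤; toℕ<n; inject≤-injective; remQuot-combine; suc-injective)
open import Data.Fin.Subset
  using (Subset; ∣_∣; _∈_; _∉_; _⊆_; _∩_; _∪_; _─_; _-_; ∁; ⁅_⁆; inside; outside)
  renaming (⊤ to Full; ⊥ to Empty)
open import Data.Fin.Subset.Properties
  using (_∈?_; ∉⊥; ∈⊤; ∣⊤∣≡n; ∣⊥∣≡0; ∣p∣≤n; ∣⁅x⁆∣≡1; x∈⁅x⁆; x∈⁅y⁆⇒x≡y; x∉⁅y⁆⇒x≢y; p⊆q⇒∣p∣≤∣q∣; ⊆-antisym;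
         p⊂q⇒∣p∣<∣q∣; x∈∁p⇒x∉p; x∈p∩q⁺; x∈p∩q⁻; x∈p∪q⁺; ∣p─q∣≤∣p∣; p─q⊆p)
open import Data.Vec using (_∷_; []; here; there; tabulate)
open import Data.Vec.Properties using (lookup∘tabulate; []=⇒lookup; lookup⇒[]=; ≡-dec)
open import Data.Product using (Σ-syntax; ∃-syntax; _,_; proj₁; proj₂)
open import Data.Sum using (_⊎_; inj₁; inj₂)
open import Data.Empty using (⊥; ⊥-elim)
open import Data.Unit using (tt)
open import Function using (_∘_; Equivalence)
open import Relation.Nullary using (Dec; yes; no; isYes; ¬?; contradiction)
open import Relation.Nullary.Decidable using (toWitness; fromWitness; _⊎-dec_; _×-dec_)
open import Relation.Binary.PropositionalEquality
  using (_≡_; _≢_; refl; trans; cong; cong₂; subst; module ≡-Reasoning)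
  renaming (sym to ≡-sym)
open import Relation.Binary.PropositionalEquality.Properties using (subst-injective)

∈tabulate⁺ : ∀ {m} {f : Fin m → Bool} {x} → f x ≡ true → x ∈ tabulate f
∈tabulate⁺ {f = f} {x} fx = lookup⇒[]= x (tabulate f) (trans (lookup∘tabulate f x) fx)

∈tabulate⁻ : ∀ {m} {f : Fin m → Bool} {x} → x ∈ tabulate f → f x ≡ true
∈tabulate⁻ {f = f} {x} x∈ = trans (≡-sym (lookup∘tabulate f x)) ([]=⇒lookup x∈)

subsetOf : ∀ {m} {Q : Fin m → Set} → (∀ x → Dec (Q x)) → Subset m
subsetOf Q? = tabulate (λ x → isYes (Q? x))

∈subsetOf⁺ : ∀ {m} {Q : Fin m → Set} (Q? : ∀ x → Dec (Q x)) {x} → Q x → x ∈ subsetOf Q?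
∈subsetOf⁺ Q? {x} q = ∈tabulate⁺ (Equivalence.to T-≡ (fromWitness {a? = Q? x} q))

∈subsetOf⁻ : ∀ {m} {Q : Fin m → Set} (Q? : ∀ x → Dec (Q x)) {x} → x ∈ subsetOf Q? → Q x
∈subsetOf⁻ Q? {x} x∈ = toWitness {a? = Q? x} (Equivalence.from T-≡ (∈tabulate⁻ x∈))

x∈p─q⇒x∉q : ∀ {m} {x : Fin m} (p q : Subset m) → x ∈ p ─ q → x ∉ q
x∈p─q⇒x∉q (s ∷ p) (outside ∷ q) (there x∈p─q) (there x∈q) = x∈p─q⇒x∉q p q x∈p─q x∈q
x∈p─q⇒x∉q (s ∷ p) (inside ∷ q) (there x∈p─q) (there x∈q) = x∈p─q⇒x∉q p q x∈p─q x∈q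

∣p∪q∣≤∣p∣+∣q∣ : ∀ {m} (p q : Subset m) → ∣ p ∪ q ∣ ≤ ∣ p ∣ + ∣ q ∣
∣p∪q∣≤∣p∣+∣q∣ [] [] = z≤n
∣p∪q∣≤∣p∣+∣q∣ (inside ∷ p) (inside ∷ q) = s≤s (≤-trans (∣p∪q∣≤∣p∣+∣q∣ p q) (+-monoʳ-≤ ∣ p ∣ (n≤1+n ∣ q ∣)))
∣p∪q∣≤∣p∣+∣q∣ (inside ∷ p) (outside ∷ q) = s≤s (∣p∪q∣≤∣p∣+∣q∣ p q)
∣p∪q∣≤∣p∣+∣q∣ (outside ∷ p) (inside ∷ q) = ≤-trans (s≤s (∣p∪q∣≤∣p∣+∣q∣ p q)) (≤-reflexive (≡-sym (+-suc ∣ p ∣ ∣ q ∣)))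
∣p∪q∣≤∣p∣+∣q∣ (outside ∷ p) (outside ∷ q) = ∣p∪q∣≤∣p∣+∣q∣ p q

∣p∣≤∣p─q∣+∣q∣ : ∀ {m} (p q : Subset m) → ∣ p ∣ ≤ ∣ p ─ q ∣ + ∣ q ∣
∣p∣≤∣p─q∣+∣q∣ [] [] = z≤n
∣p∣≤∣p─q∣+∣q∣ (inside ∷ p) (inside ∷ q) = ≤-trans (s≤s (∣p∣≤∣p─q∣+∣q∣ p q)) (≤-reflexive (≡-sym (+-suc _ ∣ q ∣)))
∣p∣≤∣p─q∣+∣q∣ (inside ∷ p) (outside ∷ q) = s≤s (∣p∣≤∣p─q∣+∣q∣ p q)
∣p∣≤∣p─q∣+∣q∣ (outside ∷ p) (inside ∷ q) = ≤-trans (∣p∣≤∣p─q∣+∣q∣ p q) (+-monoʳ-≤ ∣ p ─ q ∣ (n≤1+n ∣ q ∣))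
∣p∣≤∣p─q∣+∣q∣ (outside ∷ p) (outside ∷ q) = ∣p∣≤∣p─q∣+∣q∣ p q

∣p─q∣-lower : ∀ {m} a (p q : Subset m) → a + ∣ q ∣ ≤ ∣ p ∣ → a ≤ ∣ p ─ q ∣
∣p─q∣-lower a p q a+q≤p = +-cancelʳ-≤ ∣ q ∣ a _ (≤-trans a+q≤p (∣p∣≤∣p─q∣+∣q∣ p q))

∣p-x∣-lower : ∀ {m} a (p : Subset m) x → suc a ≤ ∣ p ∣ → a ≤ ∣ p - x ∣
∣p-x∣-lower a p x 1+a≤p =
  ∣p─q∣-lower a p ⁅ x ⁆ (subst (λ c → a + c ≤ ∣ p ∣) (≡-sym (∣⁅x⁆∣≡1 x)) (subst (_≤ ∣ p ∣) (+-comm 1 a) 1+a≤p))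

⊆∧≢⇒∣<∣ : ∀ {m} {p q : Subset m} → p ⊆ q → p ≢ q → ∣ p ∣ < ∣ q ∣
⊆∧≢⇒∣<∣ {p = p} {q} p⊆q p≢q with any? (λ x → x ∈? q ×-dec ¬? (x ∈? p))
... | yes (x , x∈q , x∉p) = p⊂q⇒∣p∣<∣q∣ (p⊆q , x , x∈q , x∉p)
... | no ∄new = contradiction (⊆-antisym p⊆q q⊆p) p≢q
  where
  q⊆p : q ⊆ p
  q⊆p {x} x∈q with x ∈? p
  ... | yes x∈p = x∈p
  ... | no x∉p = contradiction (x , x∈q , x∉p) ∄new

⊆-ofSize : ∀ {m} k (p : Subset m) → k ≤ ∣ p ∣ → Σ[ q ∈ Subset m ] q ⊆ p × ∣ q ∣ ≡ k
⊆-ofSize {m} zero p _ = Empty , (λ x∈∅ → contradiction x∈∅ ∉⊥) , ∣⊥∣≡0 m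
⊆-ofSize (suc k) (inside ∷ p) (s≤s k≤p) with ⊆-ofSize k p k≤p
... | q , q⊆p , ∣q∣≡k = inside ∷ q , ∷⊆ , cong suc ∣q∣≡k
  where
  ∷⊆ : inside ∷ q ⊆ inside ∷ p
  ∷⊆ here = here
  ∷⊆ (there x∈q) = there (q⊆p x∈q)
⊆-ofSize (suc k) (outside ∷ p) k<p with ⊆-ofSize (suc k) p k<p
... | q , q⊆p , ∣q∣≡k = outside ∷ q , ∷⊆ , ∣q∣≡k
  where
  ∷⊆ : outside ∷ q ⊆ outside ∷ p
  ∷⊆ (there x∈q) = there (q⊆p x∈q)

⋃[_]_ : ∀ {m p} → Subset m → (Fin m → Subset p) → Subset p
⋃[ [] ] f = Empty
⋃[ inside ∷ U ] f = f zero ∪ ⋃[ U ] (f ∘ suc)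
⋃[ outside ∷ U ] f = ⋃[ U ] (f ∘ suc)

∈⋃⁺ : ∀ {m p} (U : Subset m) (f : Fin m → Subset p) {u y} → u ∈ U → y ∈ f u → y ∈ ⋃[ U ] f
∈⋃⁺ (inside ∷ U) f here y∈fu = x∈p∪q⁺ (inj₁ y∈fu)
∈⋃⁺ (inside ∷ U) f (there u∈U) y∈fu = x∈p∪q⁺ (inj₂ (∈⋃⁺ U (f ∘ suc) u∈U y∈fu))
∈⋃⁺ (outside ∷ U) f (there u∈U) y∈fu = ∈⋃⁺ U (f ∘ suc) u∈U y∈fu

∣⋃∣≤ : ∀ {m p} (U : Subset m) (f : Fin m → Subset p) c → (∀ u → u ∈ U → ∣ f u ∣ ≤ c) → ∣ ⋃[ U ] f ∣ ≤ ∣ U ∣ * c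
∣⋃∣≤ {p = p} [] f c _ = ≤-reflexive (∣⊥∣≡0 p)
∣⋃∣≤ (inside ∷ U) f c ∣f∣≤c = ≤-trans (∣p∪q∣≤∣p∣+∣q∣ (f zero) (⋃[ U ] (f ∘ suc)))
  (+-mono-≤ (∣f∣≤c zero here) (∣⋃∣≤ U (f ∘ suc) c (λ u u∈U → ∣f∣≤c (suc u) (there u∈U))))
∣⋃∣≤ (outside ∷ U) f c ∣f∣≤c = ∣⋃∣≤ U (f ∘ suc) c (λ u u∈U → ∣f∣≤c (suc u) (there u∈U))

emb∈ : ∀ {m} (X : Subset m) i → emb X i ∈ X
emb∈ (inside ∷ X) zero = here
emb∈ (inside ∷ X) (suc i) = there (emb∈ X i)
emb∈ (outside ∷ X) i = there (emb∈ X i)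

emb-injective : ∀ {m} (X : Subset m) {i j} → emb X i ≡ emb X j → i ≡ j
emb-injective (inside ∷ X) {zero} {zero} _ = refl
emb-injective (inside ∷ X) {suc i} {suc j} e = cong suc (emb-injective X (suc-injective e))
emb-injective (outside ∷ X) e = emb-injective X (suc-injective e)

emb-surjective : ∀ {m} (X : Subset m) {x} → x ∈ X → ∃[ i ] emb X i ≡ x
emb-surjective (inside ∷ X) here = zero , refl
emb-surjective (inside ∷ X) (there x∈X) with emb-surjective X x∈X
... | i , refl = suc i , refl
emb-surjective (outside ∷ X) (there x∈X) with emb-surjective X x∈X
... | i , refl = i , refl

∈pull⁺ : ∀ {a m} (e : Fin a → Fin m) {W : Subset m} {i} → e i ∈ W → i ∈ pull e W
∈pull⁺ e ei∈W = ∈tabulate⁺ ([]=⇒lookup ei∈W)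

∈pull⁻ : ∀ {a m} (e : Fin a → Fin m) {W : Subset m} {i} → i ∈ pull e W → e i ∈ W
∈pull⁻ e {W} i∈ = lookup⇒[]= _ W (∈tabulate⁻ i∈)

∣pull-emb-∁∣ : ∀ {m} (S W : Subset m) → ∣ pull (emb (∁ S)) W ∣ ≡ ∣ W ─ S ∣
∣pull-emb-∁∣ [] [] = refl
∣pull-emb-∁∣ (inside ∷ S) (_ ∷ W) = ∣pull-emb-∁∣ S W
∣pull-emb-∁∣ (outside ∷ S) (inside ∷ W) = cong suc (∣pull-emb-∁∣ S W)
∣pull-emb-∁∣ (outside ∷ S) (outside ∷ W) = ∣pull-emb-∁∣ S W

survivors : ∀ {m} (S A : Subset m) a b → ∣ S ∣ ≤ b → a + b ≤ ∣ A ∣ →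
  Σ[ A′ ∈ Subset ∣ ∁ S ∣ ] (∀ {i} → i ∈ A′ → emb (∁ S) i ∈ A) × ∣ A′ ∣ ≡ a
survivors S A a b ∣S∣≤b a+b≤∣A∣ =
  let A′ , A′⊆ , ∣A′∣≡a = ⊆-ofSize a (pull (emb (∁ S)) A) (subst (a ≤_) (≡-sym (∣pull-emb-∁∣ S A)) a≤∣A─S∣)
  in A′ , ∈pull⁻ (emb (∁ S)) ∘ A′⊆ , ∣A′∣≡a
  where
  a≤∣A─S∣ : a ≤ ∣ A ─ S ∣
  a≤∣A─S∣ = ∣p─q∣-lower a A S (≤-trans (+-monoʳ-≤ a ∣S∣≤b) a+b≤∣A∣)

snoc : ∀ {G u w v ℓ} → Walk G u w ℓ → adj G w v ≡ true → Walk G u v (suc ℓ)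
snoc [] wv = wv ∷ []
snoc (uw ∷ p) wv = uw ∷ snoc p wv

reverse : ∀ {G u v ℓ} → Walk G u v ℓ → Walk G v u ℓ
reverse [] = []
reverse {G} (_∷_ {u} {w} uw p) = snoc (reverse p) (trans (sym G w u) uw)

_++ʷ_ : ∀ {G u w v a b} → Walk G u w a → Walk G w v b → Walk G u v (a + b)
[] ++ʷ q = q
(uw ∷ p) ++ʷ q = uw ∷ (p ++ʷ q)

within-sym : ∀ {G} r {u v} → Within G r u v → Within G r v u
within-sym r (ℓ , ℓ≤r , p) = ℓ , ℓ≤r , reverse p

within-weaken : ∀ {G} {a} r {u v} → Within G (fin a) u v → a ≤∞ r → Within G r u v
within-weaken (fin r) (ℓ , ℓ≤a , p) a≤r = ℓ , ≤-trans ℓ≤a a≤r , p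
within-weaken ∞ (ℓ , _ , p) _ = ℓ , tt , p

stretch : ∀ {G′ G : Graph} (e : Fin (n G′) → Fin (n G)) →
  (∀ {x y} → adj G′ x y ≡ true → Within G (fin 3) (e x) (e y)) →
  ∀ r {x y} → Within G′ r x y → Within G (3× r) (e x) (e y)
stretch {G′} {G} e short r (ℓ , ℓ≤r , p) = within-weaken (3× r) (walk p) (3ℓ≤3r r ℓ≤r)
  where
  walk : ∀ {x y ℓ} → Walk G′ x y ℓ → Within G (fin (ℓ * 3)) (e x) (e y)
  walk [] = 0 , z≤n , []
  walk (xw ∷ p) with short xw | walk p
  ... | a , a≤3 , q | b , b≤ , q′ = a + b , +-mono-≤ a≤3 b≤ , q ++ʷ q′
  3ℓ≤3r : ∀ r → ℓ ≤∞ r → (ℓ * 3) ≤∞ (3× r)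
  3ℓ≤3r (fin r) ℓ≤r = ≤-trans (≤-reflexive (*-comm ℓ 3)) (*-monoʳ-≤ 3 ℓ≤r)
  3ℓ≤3r ∞ _ = tt

module Layers (G : Graph) (v : Fin (n G)) where

  grow : Subset (n G) → Subset (n G)
  grow P = subsetOf (λ u → (u ∈? P) ⊎-dec any? (λ w → (w ∈? P) ×-dec (adj G u w ≟ᵇ true)))

  layer : ℕ → Subset (n G)
  layer zero = ⁅ v ⁆
  layer (suc i) = grow (layer i)

  layer-sound : ∀ i {u} → u ∈ layer i → Within G (fin i) u v
  layer-sound zero {u} u∈ with x∈⁅y⁆⇒x≡y v u∈
  ... | refl = 0 , z≤n , []
  layer-sound (suc i) u∈ with ∈subsetOf⁻ _ u∈
  ... | inj₁ u∈layer = within-weaken (fin (suc i)) (layer-sound i u∈layer) (n≤1+n i)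
  ... | inj₂ (w , w∈layer , uw) with layer-sound i w∈layer
  ...   | ℓ , ℓ≤i , p = suc ℓ , s≤s ℓ≤i , uw ∷ p

  layer-complete : ∀ i {u ℓ} → ℓ ≤ i → Walk G u v ℓ → u ∈ layer i
  layer-complete zero z≤n [] = x∈⁅x⁆ v
  layer-complete (suc i) _ [] = ∈subsetOf⁺ _ (inj₁ (layer-complete i z≤n []))
  layer-complete (suc i) (s≤s ℓ≤i) (_∷_ {w = w} uw p) = ∈subsetOf⁺ _ (inj₂ (w , layer-complete i ℓ≤i p , uw))

  layer-⊆ : ∀ i → layer i ⊆ layer (suc i)
  layer-⊆ i u∈ = ∈subsetOf⁺ _ (inj₁ u∈)

  stays : ∀ {i} → layer i ≡ layer (suc i) → ∀ d → layer (d + i) ≡ layer i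
  stays eq zero = refl
  stays eq (suc d) = trans (cong grow (stays eq d)) (≡-sym eq)

  stabilises-or-grows : ∀ i → (∃[ j ] layer j ≡ layer (suc j)) ⊎ suc i ≤ ∣ layer i ∣
  stabilises-or-grows zero = inj₂ (≤-reflexive (≡-sym (∣⁅x⁆∣≡1 v)))
  stabilises-or-grows (suc i) with stabilises-or-grows i
  ... | inj₁ stable = inj₁ stable
  ... | inj₂ i<∣layer∣ with ≡-dec _≟ᵇ_ (layer i) (layer (suc i))
  ...   | yes eq = inj₁ (i , eq)
  ...   | no neq = inj₂ (≤-trans (s≤s i<∣layer∣) (⊆∧≢⇒∣<∣ (layer-⊆ i) neq))

  stabilises : ∃[ j ] layer j ≡ layer (suc j)
  stabilises with stabilises-or-grows (n G)
  ... | inj₁ stable = stable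
  ... | inj₂ n<∣layer∣ = contradiction (≤-trans n<∣layer∣ (∣p∣≤n (layer (n G)))) (<-irrefl refl)

ball : ∀ (G : Graph) r v → ∃[ X ] IsBall G r v X
ball G (fin r) v =
  layer r , λ u → within-sym (fin r) ∘ layer-sound r , λ (ℓ , ℓ≤r , p) → layer-complete r ℓ≤r (reverse p)
  where open Layers G v
ball G ∞ v = layer j , λ u → sound , complete
  where
  open Layers G v
  j : ℕ
  j = proj₁ stabilises
  sound : ∀ {u} → u ∈ layer j → Within G ∞ v u
  sound u∈ = within-sym ∞ (within-weaken ∞ (layer-sound j u∈) tt)
  complete : ∀ {u} → Within G ∞ v u → u ∈ layer j
  complete {u} (ℓ , _ , p) = subst (u ∈_) (stays (proj₂ stabilises) ℓ) (layer-complete (ℓ + j) (m≤m+n ℓ j) (reverse p))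

record Embedding (G′ G : Graph) : Set where
  field
    map       : Fin (n G′) → Fin (n G)
    injective : ∀ {x y} → map x ≡ map y → x ≡ y
    adj-≡     : ∀ x y → adj G′ x y ≡ adj G (map x) (map y)

  within : ∀ r {x y} → Within G′ r x y → Within G r (map x) (map y)
  within r (ℓ , ℓ≤r , p) = ℓ , ℓ≤r , walk p
    where
    walk : ∀ {x y ℓ} → Walk G′ x y ℓ → Walk G (map x) (map y) ℓ
    walk [] = []
    walk (_∷_ {u} {w} uw p) = trans (≡-sym (adj-≡ u w)) uw ∷ walk p

open Embedding

adj≡true⇒≢ : ∀ (G : Graph) {u v} → adj G u v ≡ true → u ≢ v
adj≡true⇒≢ G {u} uv refl with () ← trans (≡-sym uv) (irr G u)

mkEmbedding : ∀ {G′ G : Graph} (e : Fin (n G′) → Fin (n G)) → (∀ {x y} → e x ≡ e y → x ≡ y) →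
  (∀ x y → x ≢ y → adj G′ x y ≡ adj G (e x) (e y)) → Embedding G′ G
mkEmbedding {G′} {G} e e-inj off-diagonal = record { map = e ; injective = e-inj ; adj-≡ = adj-≡′ }
  where
  adj-≡′ : ∀ x y → adj G′ x y ≡ adj G (e x) (e y)
  adj-≡′ x y with x ≟ y
  ... | yes refl = trans (irr G′ x) (≡-sym (irr G (e x)))
  ... | no x≢y = off-diagonal x y x≢y

_∘ᴱ_ : ∀ {G″ G′ G} → Embedding G′ G → Embedding G″ G′ → Embedding G″ G
E ∘ᴱ E′ = record
  { map = map E ∘ map E′
  ; injective = injective E′ ∘ injective E
  ; adj-≡ = λ x y → trans (adj-≡ E′ x y) (adj-≡ E _ _)
  }

induced-Embedding : ∀ (G : Graph) X → Embedding (induced G X) G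
induced-Embedding G X = record { map = emb X ; injective = emb-injective X ; adj-≡ = λ _ _ → refl }

into-induced : ∀ {G′ G} (E : Embedding G′ G) X → (∀ x → map E x ∈ X) → Embedding G′ (induced G X)
into-induced {G′} {G} E X E⊆X = record
  { map = e
  ; injective = λ {x} {y} ex≡ey → injective E (trans (≡-sym (emb-e x)) (trans (cong (emb X) ex≡ey) (emb-e y)))
  ; adj-≡ = λ x y → trans (adj-≡ E x y) (cong₂ (adj G) (≡-sym (emb-e x)) (≡-sym (emb-e y)))
  }
  where
  e : Fin (n G′) → Fin ∣ X ∣
  e x = proj₁ (emb-surjective X (E⊆X x))
  emb-e : ∀ x → emb X (e x) ≡ map E x
  emb-e x = proj₂ (emb-surjective X (E⊆X x))

ball-Embedding : ∀ {G′ G} (E : Embedding G′ G) r {v X′ X} → IsBall G′ r v X′ → IsBall G r (map E v) X →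
  Embedding (induced G′ X′) (induced G X)
ball-Embedding {G′} {G} E r {v} {X′} {X} X′-ball X-ball = into-induced (E ∘ᴱ induced-Embedding G′ X′) X inside-X
  where
  inside-X : ∀ i → map E (emb X′ i) ∈ X
  inside-X i = proj₂ (X-ball _) (within E r (proj₁ (X′-ball (emb X′ i)) (emb∈ X′ i)))

Ktt-free-Embedding : ∀ {t G′ G} → Embedding G′ G → ¬ ContainsKtt t G → ¬ ContainsKtt t G′
Ktt-free-Embedding E Ktt-free (a , b , a-inj , b-inj , a≢b , a—b) =
  Ktt-free (map E ∘ a , map E ∘ b , (λ i j → a-inj i j ∘ injective E) , (λ i j → b-inj i j ∘ injective E) ,
            (λ i j → a≢b i j ∘ injective E) , λ i j → trans (≡-sym (adj-≡ E (a i) (b j))) (a—b i j))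

nonNbrs : (G : Graph) → Fin (n G) → Subset (n G)
nonNbrs G u = tabulate (λ x → not (adj G u x))

∈nonNbrs⁺ : ∀ {G : Graph} {u x} → adj G u x ≡ false → x ∈ nonNbrs G u
∈nonNbrs⁺ ux = ∈tabulate⁺ (cong not ux)

∈nonNbrs⁻ : ∀ {G : Graph} {u x} → x ∈ nonNbrs G u → adj G u x ≡ false
∈nonNbrs⁻ {G} {u} {x} x∈ = trans (≡-sym (not-involutive (adj G u x))) (cong not (∈tabulate⁻ x∈))

sparse : (G : Graph) → ℕ → Subset (n G) → Subset (n G)
sparse G c P = subsetOf (λ u → ∣ P ∩ nonNbrs G u ∣ <? c)

enumerate : ∀ {m k} (X : Subset m) → k ≤ ∣ X ∣ → Fin k → Fin m
enumerate X k≤∣X∣ i = emb X (inject≤ i k≤∣X∣)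

enumerate-injective : ∀ {m k} (X : Subset m) (k≤∣X∣ : k ≤ ∣ X ∣) i j →
  enumerate X k≤∣X∣ i ≡ enumerate X k≤∣X∣ j → i ≡ j
enumerate-injective X k≤∣X∣ i j e = inject≤-injective k≤∣X∣ k≤∣X∣ i j (emb-injective X e)

module KttFree {t : ℕ} {G : Graph} (Ktt-free : ¬ ContainsKtt t G) where

  nonEdge-among : ∀ (a b : Fin t → Fin (n G)) → (∀ i j → a i ≡ a j → i ≡ j) → (∀ i j → b i ≡ b j → i ≡ j) →
    (∀ i j → a i ≢ b j) → ∃[ i ] ∃[ j ] adj G (a i) (b j) ≡ false
  nonEdge-among a b a-inj b-inj a≢b with any? (λ i → any? (λ j → adj G (a i) (b j) ≟ᵇ false))
  ... | yes found = found
  ... | no none = contradiction (a , b , a-inj , b-inj , a≢b , λ i j → ¬-not (λ ij → none (i , j , ij))) Ktt-free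

  nonEdge-between : ∀ (A B : Subset (n G)) → Disjoint A B → t ≤ ∣ A ∣ → t ≤ ∣ B ∣ →
    ∃[ x ] ∃[ y ] x ∈ A × y ∈ B × adj G x y ≡ false
  nonEdge-between A B A∩B=∅ t≤∣A∣ t≤∣B∣ =
    let i , j , ij = nonEdge-among a b (enumerate-injective A t≤∣A∣) (enumerate-injective B t≤∣B∣) a≢b
    in a i , b j , emb∈ A _ , emb∈ B _ , ij
    where
    a b : Fin t → Fin (n G)
    a = enumerate A t≤∣A∣
    b = enumerate B t≤∣B∣
    a≢b : ∀ i j → a i ≢ b j
    a≢b i j ai≡bj = A∩B=∅ (a i) (emb∈ A _) (subst (_∈ B) (≡-sym ai≡bj) (emb∈ B _))

  -- t sparse vertices would miss at most t c vertices of P, leaving t common neighbours.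
  few-sparse : ∀ c (P : Subset (n G)) → t + (t * c + t) ≤ ∣ P ∣ → ∣ sparse G c P ∣ < t
  few-sparse c P big = ≰⇒> many-sparse-impossible
    where
    many-sparse-impossible : ¬ t ≤ ∣ sparse G c P ∣
    many-sparse-impossible t≤ with ⊆-ofSize t (sparse G c P) t≤
    ... | U , U⊆sparse , ∣U∣≡t with nonEdge-between U R U∩R=∅ (≤-reflexive (≡-sym ∣U∣≡t)) t≤∣R∣
      where
      D R : Subset (n G)
      D = ⋃[ U ] (λ u → P ∩ nonNbrs G u)
      R = P ─ (D ∪ U)
      ∣D∣≤ : ∣ D ∣ ≤ t * c
      ∣D∣≤ = subst (λ s → ∣ D ∣ ≤ s * c) ∣U∣≡t
        (∣⋃∣≤ U _ c (λ u u∈U → <⇒≤ (∈subsetOf⁻ _ (U⊆sparse u∈U))))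
      t≤∣R∣ : t ≤ ∣ R ∣
      t≤∣R∣ = ∣p─q∣-lower t P (D ∪ U)
        (≤-trans (+-monoʳ-≤ t (≤-trans (∣p∪q∣≤∣p∣+∣q∣ D U) (+-mono-≤ ∣D∣≤ (≤-reflexive ∣U∣≡t)))) big)
      U∩R=∅ : Disjoint U R
      U∩R=∅ x x∈U x∈R = x∈p─q⇒x∉q P (D ∪ U) x∈R (x∈p∪q⁺ (inj₂ x∈U))
    ... | x , y , x∈U , y∈R , xy =
      x∈p─q⇒x∉q P _ y∈R (x∈p∪q⁺ (inj₁ (∈⋃⁺ U _ x∈U (x∈p∩q⁺ (p─q⊆p P _ y∈R , ∈nonNbrs⁺ {G} xy)))))

-- A flip of a K_{t,t}-free graph is approximated by a bounded deletion

flipAdj-≢ : ∀ (G : Graph) {k} (p : Fin (n G) → Fin k) F {u v} → u ≢ v →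
  flipAdj G p F u v ≡ adj G u v xor toggle F (p u) (p v)
flipAdj-≢ G p F {u} {v} u≢v with u ≟ v
... | yes u≡v = contradiction u≡v u≢v
... | no _ = refl

budget : ℕ → ℕ
budget t = t + (t * suc (t + t) + t)

module DeletionApproximation {t : ℕ} {G : Graph} (Ktt-free : ¬ ContainsKtt t G)
                             {k : ℕ} (part : Fin (n G) → Fin k) (F : Fin k → Fin k → Bool) where

  open KttFree {t} {G} Ktt-free

  H : Graph
  H = flipG G part F

  class : Fin k → Subset (n G)
  class j = subsetOf (λ x → part x ≟ j)

  deleted-for : Fin k → Subset (n G)
  deleted-for j with ∣ class j ∣ <? budget t
  ... | yes _ = class j
  ... | no _ = sparse G (suc (t + t)) (class j)

  S : Subset (n G)
  S = ⋃[ Full ] deleted-for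

  ∣deleted-for∣≤ : ∀ j → ∣ deleted-for j ∣ ≤ budget t
  ∣deleted-for∣≤ j with ∣ class j ∣ <? budget t
  ... | yes small = <⇒≤ small
  ... | no large = ≤-trans (<⇒≤ (few-sparse (suc (t + t)) (class j) (≮⇒≥ large))) (m≤m+n t _)

  ∣S∣≤ : ∣ S ∣ ≤ k * budget t
  ∣S∣≤ = subst (λ m → ∣ S ∣ ≤ m * budget t) (∣⊤∣≡n k) (∣⋃∣≤ Full deleted-for (budget t) (λ j _ → ∣deleted-for∣≤ j))

  small-class-deleted : ∀ j → ∣ class j ∣ < budget t → class j ⊆ deleted-for j
  small-class-deleted j small x∈ with ∣ class j ∣ <? budget t
  ... | yes _ = x∈
  ... | no large = contradiction small large

  sparse-deleted : ∀ j → ¬ ∣ class j ∣ < budget t → sparse G (suc (t + t)) (class j) ⊆ deleted-for j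
  sparse-deleted j large x∈ with ∣ class j ∣ <? budget t
  ... | yes small = contradiction small large
  ... | no _ = x∈

  large-outside : ∀ {u} → u ∉ S → budget t ≤ ∣ class (part u) ∣
  large-outside {u} u∉S with ∣ class (part u) ∣ <? budget t
  ... | yes small = contradiction
    (∈⋃⁺ Full deleted-for ∈⊤ (small-class-deleted (part u) small (∈subsetOf⁺ _ refl))) u∉S
  ... | no large = ≮⇒≥ large

  dense-outside : ∀ {u v} → u ∉ S → v ∉ S → suc (t + t) ≤ ∣ class (part v) ∩ nonNbrs G u ∣
  dense-outside {u} {v} u∉S v∉S with ∣ class (part v) ∩ nonNbrs G u ∣ <? suc (t + t)
  ... | yes few = contradiction
    (∈⋃⁺ Full deleted-for ∈⊤ (sparse-deleted (part v) (≤⇒≯ (large-outside v∉S)) (∈subsetOf⁺ _ few))) u∉S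
  ... | no many = ≮⇒≥ many

  flipped-edge : ∀ {u v} → u ≢ v → adj G u v ≡ false → toggle F (part u) (part v) ≡ true → adj H u v ≡ true
  flipped-edge u≢v uv uv-flipped = trans (flipAdj-≢ G part F u≢v) (cong₂ _xor_ uv uv-flipped)

  kept-edge : ∀ {u v} → adj G u v ≡ true → toggle F (part u) (part v) ≡ false → adj H u v ≡ true
  kept-edge uv uv-kept = trans (flipAdj-≢ G part F (adj≡true⇒≢ G uv)) (cong₂ _xor_ uv uv-kept)

  candidates : Fin (n G) → Fin k → Subset (n G)
  candidates u j = (class j ∩ nonNbrs G u) - u

  many-candidates : ∀ {u j} → suc (t + t) ≤ ∣ class j ∩ nonNbrs G u ∣ → t + t ≤ ∣ candidates u j ∣
  many-candidates {u} {j} = ∣p-x∣-lower (t + t) (class j ∩ nonNbrs G u) u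

  ∈candidates⁻ : ∀ {u j x} → x ∈ candidates u j → part x ≡ j × adj G u x ≡ false × x ≢ u
  ∈candidates⁻ {u} {j} x∈ with x∈p∩q⁻ (class j) (nonNbrs G u) (p─q⊆p _ ⁅ u ⁆ x∈)
  ... | x∈class , x∈nonNbrs =
    ∈subsetOf⁻ _ x∈class , ∈nonNbrs⁻ {G} x∈nonNbrs , x∉⁅y⁆⇒x≢y (x∈p─q⇒x∉q _ ⁅ u ⁆ x∈)

  -- u — y — z — v with y, z non-neighbours of u, v in the opposite classes, chosen non-adjacent by
  -- K_{t,t}-freeness: all three pairs are non-edges of G between the flipped classes.
  flipped-pair-close : ∀ {u v} → toggle F (part u) (part v) ≡ true →
    suc (t + t) ≤ ∣ class (part v) ∩ nonNbrs G u ∣ → suc (t + t) ≤ ∣ class (part u) ∩ nonNbrs G v ∣ →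
    Within H (fin 3) u v
  flipped-pair-close {u} {v} uv-flipped many-u many-v
    with ⊆-ofSize t (candidates u (part v)) (≤-trans (m≤m+n t t) (many-candidates many-u))
  ... | Y , Y⊆ , ∣Y∣≡t with nonEdge-between Y (candidates v (part u) ─ Y) Y∩Z=∅ (≤-reflexive (≡-sym ∣Y∣≡t)) t≤∣Z∣
    where
    Y∩Z=∅ : Disjoint Y (candidates v (part u) ─ Y)
    Y∩Z=∅ x x∈Y x∈Z = x∈p─q⇒x∉q (candidates v (part u)) Y x∈Z x∈Y
    t≤∣Z∣ : t ≤ ∣ candidates v (part u) ─ Y ∣
    t≤∣Z∣ = ∣p─q∣-lower t (candidates v (part u)) Y (subst (λ s → t + s ≤ _) (≡-sym ∣Y∣≡t) (many-candidates many-v))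
  ... | y , z , y∈Y , z∈Z , yz with ∈candidates⁻ (Y⊆ y∈Y) | ∈candidates⁻ (p─q⊆p _ Y z∈Z)
  ... | py≡pv , uy , y≢u | pz≡pu , vz , z≢v = 3 , ≤-refl , u—y ∷ y—z ∷ z—v ∷ []
    where
    u—y : adj H u y ≡ true
    u—y = flipped-edge (y≢u ∘ ≡-sym) uy (trans (cong (toggle F (part u)) py≡pv) uv-flipped)
    y—z : adj H y z ≡ true
    y—z = flipped-edge (λ y≡z → x∈p─q⇒x∉q _ Y z∈Z (subst (_∈ Y) y≡z y∈Y)) yz
      (trans (cong₂ (toggle F) py≡pv pz≡pu) (trans (toggle-sym F (part v) (part u)) uv-flipped))
    z—v : adj H z v ≡ true
    z—v = flipped-edge z≢v (trans (sym G z v) vz) (trans (cong (λ c → toggle F c (part v)) pz≡pu) uv-flipped)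

  shortcut : ∀ {u v} → u ∉ S → v ∉ S → adj G u v ≡ true → Within H (fin 3) u v
  shortcut {u} {v} u∉S v∉S uv with toggle F (part u) (part v) in uv-toggle
  ... | false = 1 , s≤s z≤n , kept-edge uv uv-toggle ∷ []
  ... | true = flipped-pair-close uv-toggle (dense-outside u∉S v∉S) (dense-outside v∉S u∉S)

  approximation : ∀ r {i j} → Within (delete G S) r i j → Within H (3× r) (emb (∁ S) i) (emb (∁ S) j)
  approximation = stretch (emb (∁ S)) (λ {i} {j} ij → shortcut (kept i) (kept j) ij)
    where
    kept : ∀ i → emb (∁ S) i ∉ S
    kept i = x∈∁p⇒x∉p (emb∈ (∁ S) i)

  ball-inside : ∀ r {v X Y} → IsBall (delete G S) r v X → IsBall H (3× r) (emb (∁ S) v) Y →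
    ∀ {i} → i ∈ X → emb (∁ S) i ∈ Y
  ball-inside r X-ball Y-ball i∈X = proj₂ (Y-ball _) (approximation r (proj₁ (X-ball _) i∈X))

deletion-breakable : ∀ {t C} r → (∀ G → C G → ¬ ContainsKtt t G) → FlipBreakable (3× r) C → DeletionBreakable r C
deletion-breakable {t} r Ktt-free (M , k , flip-breaks) = (λ m → M (m + k * budget t)) , k * budget t ,
  λ G G∈C m W big →
    let part , F , A , B , A⊆W , B⊆W , A∩B=∅ , ∣A∣≡ , ∣B∣≡ , far = flip-breaks G G∈C (m + k * budget t) W big
        open DeletionApproximation {G = G} (Ktt-free G G∈C) part F
        A′ , in-A , ∣A′∣≡m = survivors S A m (k * budget t) ∣S∣≤ (≤-reflexive (≡-sym ∣A∣≡))
        B′ , in-B , ∣B′∣≡m = survivors S B m (k * budget t) ∣S∣≤ (≤-reflexive (≡-sym ∣B∣≡))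
    in S , ∣S∣≤ , A′ , B′ , (λ _ → A⊆W ∘ in-A) , (λ _ → B⊆W ∘ in-B) ,
       (λ i i∈A′ i∈B′ → A∩B=∅ _ (in-A i∈A′) (in-B i∈B′)) , ∣A′∣≡m , ∣B′∣≡m ,
       λ u v u∈A′ v∈B′ → far _ _ (in-A u∈A′) (in-B v∈B′) ∘ approximation r

deletion-flat : ∀ {t C} r → (∀ G → C G → ¬ ContainsKtt t G) → FlipFlat (3× r) C → DeletionFlat r C
deletion-flat {t} r Ktt-free (M , k , flip-flat) = (λ m → M (m + k * budget t)) , k * budget t ,
  λ G G∈C m W big →
    let part , F , A , A⊆W , ∣A∣≡ , far = flip-flat G G∈C (m + k * budget t) W big
        open DeletionApproximation {G = G} (Ktt-free G G∈C) part F
        A′ , in-A , ∣A′∣≡m = survivors S A m (k * budget t) ∣S∣≤ (≤-reflexive (≡-sym ∣A∣≡))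
    in S , ∣S∣≤ , A′ , (λ _ → A⊆W ∘ in-A) , ∣A′∣≡m ,
       λ u v u∈A′ v∈A′ u≢v → far _ _ (in-A u∈A′) (in-A v∈A′) (u≢v ∘ emb-injective (∁ S)) ∘ approximation r

deletion-separable : ∀ {t C} r → (∀ G → C G → ¬ ContainsKtt t G) → FlipSeparable (3× r) C → DeletionSeparable r C
deletion-separable {t} r Ktt-free (k , flip-separates) = k * budget t ,
  λ G G∈C W →
    let part , F , balanced = flip-separates G G∈C W
        open DeletionApproximation {G = G} (Ktt-free G G∈C) part F
    in S , ∣S∣≤ , λ v X X-ball →
      let Y , Y-ball = ball H (3× r) (emb (∁ S) v)
          X∩W⊆ : X ∩ pull (emb (∁ S)) W ⊆ pull (emb (∁ S)) (Y ∩ W)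
          X∩W⊆ i∈ = let i∈X , i∈W = x∈p∩q⁻ X _ i∈
                    in ∈pull⁺ (emb (∁ S)) (x∈p∩q⁺ (ball-inside r X-ball Y-ball i∈X , ∈pull⁻ (emb (∁ S)) i∈W))
      in begin
        ∣ X ∩ pull (emb (∁ S)) W ∣   ≤⟨ p⊆q⇒∣p∣≤∣q∣ X∩W⊆ ⟩
        ∣ pull (emb (∁ S)) (Y ∩ W) ∣ ≡⟨ ∣pull-emb-∁∣ S (Y ∩ W) ⟩
        ∣ (Y ∩ W) ─ S ∣             ≤⟨ ∣p─q∣≤∣p∣ (Y ∩ W) S ⟩
        ∣ Y ∩ W ∣                   ≤⟨ balanced (emb (∁ S) v) Y Y-ball ⟩
        ⌈ ∣ W ∣ /2⌉                 ∎
  where open ≤-Reasoning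

-- Flipper rank and splitter rank

-- A symmetric matrix is realised by flipping, for i ≤ j, the pair (i , j) exactly when T i j holds.
toggle-realises : ∀ {κ} (T : Fin κ → Fin κ → Bool) → (∀ i j → T i j ≡ T j i) →
  ∃[ F ] ∀ i j → toggle F i j ≡ T i j
toggle-realises {κ} T T-sym = F , toggle-F
  where
  F : Fin κ → Fin κ → Bool
  F i j with toℕ i ≤? toℕ j
  ... | yes _ = T i j
  ... | no _ = false
  toggle-F : ∀ i j → toggle F i j ≡ T i j
  toggle-F i j with i ≟ j
  ... | yes refl with toℕ i ≤? toℕ i
  ...   | yes _ = refl
  ...   | no i≰i = contradiction ≤-refl i≰i
  toggle-F i j | no i≢j with toℕ i ≤? toℕ j | toℕ j ≤? toℕ i
  ... | yes i≤j | yes j≤i = contradiction (toℕ-injective (≤-antisym i≤j j≤i)) i≢j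
  ... | yes _ | no _ = xor-identityʳ (T i j)
  ... | no _ | yes _ = T-sym j i
  ... | no i≰j | no j≰i with ≤-total (toℕ i) (toℕ j)
  ...   | inj₁ i≤j = contradiction i≤j i≰j
  ...   | inj₂ j≤i = contradiction j≤i j≰i

toggle-inject≤ : ∀ {κ κ′} (κ≤κ′ : κ ≤ κ′) (F : Fin κ → Fin κ → Bool) →
  ∃[ F′ ] ∀ i j → toggle F′ (inject≤ i κ≤κ′) (inject≤ j κ≤κ′) ≡ toggle F i j
toggle-inject≤ {zero} _ F = (λ _ _ → false) , λ ()
toggle-inject≤ {suc κ} {κ′} κ≤κ′ F =
  let F′ , F′-realises = toggle-realises (λ i j → toggle F (retract i) (retract j))
                                         (λ i j → toggle-sym F (retract i) (retract j))
  in F′ , λ i j → trans (F′-realises (inject≤ i κ≤κ′) (inject≤ j κ≤κ′))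
                        (cong₂ (toggle F) (retract-inject≤ i) (retract-inject≤ j))
  where
  retract : Fin κ′ → Fin (suc κ)
  retract i with toℕ i <? suc κ
  ... | yes i<1+κ = fromℕ< i<1+κ
  ... | no _ = zero
  retract-inject≤ : ∀ i → retract (inject≤ i κ≤κ′) ≡ i
  retract-inject≤ i with toℕ (inject≤ i κ≤κ′) <? suc κ
  ... | yes i<1+κ = toℕ-injective (trans (toℕ-fromℕ< i<1+κ) (toℕ-inject≤ i κ≤κ′))
  ... | no i≮1+κ = contradiction (subst (_< suc κ) (≡-sym (toℕ-inject≤ i κ≤κ′)) (toℕ<n i)) i≮1+κ

toggle-combine : ∀ {κ κ₀} (F : Fin κ → Fin κ → Bool) (F₀ : Fin κ₀ → Fin κ₀ → Bool) →
  ∃[ F′ ] ∀ a b c d → toggle F′ (combine a b) (combine c d) ≡ toggle F a c xor toggle F₀ b d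
toggle-combine {κ} {κ₀} F F₀ =
  let F′ , F′-realises = toggle-realises T T-sym
  in F′ , λ a b c d → trans (F′-realises (combine a b) (combine c d))
    (cong₂ (λ ab cd → toggle F (proj₁ ab) (proj₁ cd) xor toggle F₀ (proj₂ ab) (proj₂ cd))
           (remQuot-combine a b) (remQuot-combine c d))
  where
  split : Fin (κ * κ₀) → Fin κ × Fin κ₀
  split = remQuot {κ} κ₀
  T : Fin (κ * κ₀) → Fin (κ * κ₀) → Bool
  T i j = toggle F (proj₁ (split i)) (proj₁ (split j)) xor toggle F₀ (proj₂ (split i)) (proj₂ (split j))
  T-sym : ∀ i j → T i j ≡ T j i
  T-sym i j = cong₂ _xor_ (toggle-sym F (proj₁ (split i)) (proj₁ (split j)))
                          (toggle-sym F₀ (proj₂ (split i)) (proj₂ (split j)))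

xor-cancelʳ : ∀ a b c → (a xor b) xor (c xor b) ≡ a xor c
xor-cancelʳ false false false = refl
xor-cancelʳ false false true = refl
xor-cancelʳ false true false = refl
xor-cancelʳ false true true = refl
xor-cancelʳ true false false = refl
xor-cancelʳ true false true = refl
xor-cancelʳ true true false = refl
xor-cancelʳ true true true = refl

xor-xor-cancel : ∀ a b → (a xor b) xor b ≡ a
xor-xor-cancel a b = trans (xor-assoc a b b) (trans (cong (a xor_) (xor-same b)) (xor-identityʳ a))

at-most-one : ∀ {a} (e : Fin a → Fin 1) → (∀ {x y} → e x ≡ e y → x ≡ y) → a ≡ 0 ⊎ a ≡ 1
at-most-one {zero} _ _ = inj₁ refl
at-most-one {suc zero} _ _ = inj₂ refl
at-most-one {suc (suc a)} e e-inj with e zero in e₀ | e (suc zero) in e₁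
... | zero | zero with () ← e-inj (trans e₀ (≡-sym e₁))

frk-empty : ∀ {r κ} ℓ {G : Graph} → n G ≡ 0 → FrkLe r κ (suc ℓ) G
frk-empty ℓ {G} n≡0 = inj₂ ((λ x → ⊥-elim (no-vertex x)) , (λ _ _ → false) , λ v → ⊥-elim (no-vertex v))
  where
  no-vertex : Fin (n G) → ⊥
  no-vertex x with subst Fin n≡0 x
  ... | ()

frk-embedding : ∀ {r κ} ℓ {G′ G} → Embedding G′ G → FrkLe r κ ℓ G → FrkLe r κ ℓ G′
frk-embedding zero E ()
frk-embedding (suc ℓ) E (inj₁ n≡1) with at-most-one (subst Fin n≡1 ∘ map E) (injective E ∘ subst-injective n≡1)
... | inj₁ n′≡0 = frk-empty ℓ n′≡0
... | inj₂ n′≡1 = inj₁ n′≡1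
frk-embedding {r} {κ} (suc ℓ) {G′} {G} E (inj₂ (p , F , balls)) = inj₂ (p ∘ map E , F , balls′)
  where
  E-flip : Embedding (flipG G′ (p ∘ map E) F) (flipG G p F)
  E-flip = mkEmbedding (map E) (injective E) flip-adj
    where
    flip-adj : ∀ x y → x ≢ y → flipAdj G′ (p ∘ map E) F x y ≡ flipAdj G p F (map E x) (map E y)
    flip-adj x y x≢y = begin
      flipAdj G′ (p ∘ map E) F x y          ≡⟨ flipAdj-≢ G′ (p ∘ map E) F x≢y ⟩
      adj G′ x y xor τ                      ≡⟨ cong (_xor τ) (adj-≡ E x y) ⟩
      adj G (map E x) (map E y) xor τ       ≡⟨ flipAdj-≢ G p F (x≢y ∘ injective E) ⟨
      flipAdj G p F (map E x) (map E y)     ∎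
      where
      open ≡-Reasoning
      τ : Bool
      τ = toggle F (p (map E x)) (p (map E y))
  balls′ : ∀ v X → IsBall (flipG G′ (p ∘ map E) F) r v X → FrkLe r κ ℓ (induced (flipG G′ (p ∘ map E) F) X)
  balls′ v X X-ball =
    let Y , Y-ball = ball (flipG G p F) r (map E v)
    in frk-embedding ℓ (ball-Embedding E-flip r X-ball Y-ball) (balls (map E v) Y Y-ball)

frk-mono : ∀ {r κ κ′} ℓ {G} → κ ≤ κ′ → FrkLe r κ ℓ G → FrkLe r κ′ ℓ G
frk-mono zero _ ()
frk-mono (suc ℓ) _ (inj₁ n≡1) = inj₁ n≡1
frk-mono {r} {κ} {κ′} (suc ℓ) {G} κ≤κ′ (inj₂ (p , F , balls)) = inj₂ (p′ , F′ , balls′)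
  where
  p′ : Fin (n G) → Fin κ′
  p′ x = inject≤ (p x) κ≤κ′
  F′ : Fin κ′ → Fin κ′ → Bool
  F′ = proj₁ (toggle-inject≤ κ≤κ′ F)
  same : Embedding (flipG G p′ F′) (flipG G p F)
  same = mkEmbedding (λ x → x) (λ x≡y → x≡y) λ x y x≢y →
    trans (flipAdj-≢ G p′ F′ x≢y)
          (trans (cong (adj G x y xor_) (proj₂ (toggle-inject≤ κ≤κ′ F) (p x) (p y))) (≡-sym (flipAdj-≢ G p F x≢y)))
  balls′ : ∀ v X → IsBall (flipG G p′ F′) r v X → FrkLe r κ′ ℓ (induced (flipG G p′ F′) X)
  balls′ v X X-ball =
    let Y , Y-ball = ball (flipG G p F) r v
    in frk-embedding ℓ (ball-Embedding same r X-ball Y-ball) (frk-mono ℓ κ≤κ′ (balls v Y Y-ball))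

frk-flip : ∀ {r κ κ₀} ℓ {G} (p₀ : Fin (n G) → Fin κ₀) F₀ → FrkLe r κ ℓ G → FrkLe r (κ * κ₀) ℓ (flipG G p₀ F₀)
frk-flip zero p₀ F₀ ()
frk-flip (suc ℓ) p₀ F₀ (inj₁ n≡1) = inj₁ n≡1
frk-flip {r} {κ} {κ₀} (suc ℓ) {G} p₀ F₀ (inj₂ (p , F , balls)) = inj₂ (p′ , F′ , balls′)
  where
  p′ : Fin (n G) → Fin (κ * κ₀)
  p′ x = combine (p x) (p₀ x)
  F′ : Fin (κ * κ₀) → Fin (κ * κ₀) → Bool
  F′ = proj₁ (toggle-combine F F₀)
  G₀ : Graph
  G₀ = flipG G p₀ F₀
  same : Embedding (flipG G₀ p′ F′) (flipG G p F)
  same = mkEmbedding (λ x → x) (λ x≡y → x≡y) reflip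
    where
    reflip : ∀ x y → x ≢ y → flipAdj G₀ p′ F′ x y ≡ flipAdj G p F x y
    reflip x y x≢y = begin
      flipAdj G₀ p′ F′ x y                      ≡⟨ flipAdj-≢ G₀ p′ F′ x≢y ⟩
      flipAdj G p₀ F₀ x y xor toggle F′ (p′ x) (p′ y)
        ≡⟨ cong₂ _xor_ (flipAdj-≢ G p₀ F₀ x≢y) (proj₂ (toggle-combine F F₀) (p x) (p₀ x) (p y) (p₀ y)) ⟩
      (adj G x y xor τ₀) xor (τ xor τ₀)         ≡⟨ xor-cancelʳ (adj G x y) τ₀ τ ⟩
      adj G x y xor τ                           ≡⟨ flipAdj-≢ G p F x≢y ⟨
      flipAdj G p F x y                         ∎
      where
      open ≡-Reasoning
      τ τ₀ : Bool
      τ = toggle F (p x) (p y)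
      τ₀ = toggle F₀ (p₀ x) (p₀ y)
  κ≤κ*κ₀ : Fin κ₀ → κ ≤ κ * κ₀
  κ≤κ*κ₀ i = subst (_≤ κ * κ₀) (*-identityʳ κ) (*-monoʳ-≤ κ (≤-trans (s≤s z≤n) (toℕ<n i)))
  balls′ : ∀ v X → IsBall (flipG G₀ p′ F′) r v X → FrkLe r (κ * κ₀) ℓ (induced (flipG G₀ p′ F′) X)
  balls′ v X X-ball =
    let Y , Y-ball = ball (flipG G p F) r v
    in frk-embedding ℓ (ball-Embedding same r X-ball Y-ball) (frk-mono ℓ (κ≤κ*κ₀ (p₀ v)) (balls v Y Y-ball))

induced-reflip : ∀ (G : Graph) {k} (p : Fin (n G) → Fin k) F X →
  Embedding (induced G X) (flipG (induced (flipG G p F) X) (p ∘ emb X) F)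
induced-reflip G p F X = mkEmbedding (λ i → i) (λ i≡j → i≡j) reflip
  where
  reflip : ∀ i j → i ≢ j → adj G (emb X i) (emb X j) ≡ flipAdj (induced (flipG G p F) X) (p ∘ emb X) F i j
  reflip i j i≢j = begin
    adj G x y                                           ≡⟨ xor-xor-cancel (adj G x y) τ ⟨
    (adj G x y xor τ) xor τ                             ≡⟨ cong (_xor τ) (flipAdj-≢ G p F (i≢j ∘ emb-injective X)) ⟨
    flipAdj G p F x y xor τ                             ≡⟨ flipAdj-≢ (induced (flipG G p F) X) (p ∘ emb X) F i≢j ⟨
    flipAdj (induced (flipG G p F) X) (p ∘ emb X) F i j ∎
    where
    open ≡-Reasoning
    x y : Fin (n G)
    x = emb X i
    y = emb X j
    τ : Bool
    τ = toggle F (p x) (p y)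

srk-mono : ∀ {r k k′} ℓ {G} → k ≤ k′ → SrkLe r k ℓ G → SrkLe r k′ ℓ G
srk-mono zero _ ()
srk-mono (suc ℓ) _ (inj₁ n≡1) = inj₁ n≡1
srk-mono (suc ℓ) k≤k′ (inj₂ (S , ∣S∣≤k , balls)) =
  inj₂ (S , ≤-trans ∣S∣≤k k≤k′ , λ v X X-ball → srk-mono ℓ k≤k′ (balls v X X-ball))

-- Below the top level, balls of G - S embed into κ-flips of balls of H, whose flipper rank needs κ · κ parts.
splitter-budget : ℕ → ℕ → ℕ → ℕ
splitter-budget t zero κ = 0
splitter-budget t (suc ℓ) κ = κ * budget t + splitter-budget t ℓ (κ * κ)

srk-from-frk : ∀ {t} r ℓ κ {G} → ¬ ContainsKtt t G → FrkLe (3× r) κ ℓ G → SrkLe r (splitter-budget t ℓ κ) ℓ G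
srk-from-frk r zero κ _ ()
srk-from-frk r (suc ℓ) κ _ (inj₁ n≡1) = inj₁ n≡1
srk-from-frk {t} r (suc ℓ) κ {G} Ktt-free (inj₂ (part , F , balls)) = inj₂ (S , ≤-trans ∣S∣≤ (m≤m+n _ _) , balls′)
  where
  open DeletionApproximation {G = G} Ktt-free part F
  balls′ : ∀ v X → IsBall (delete G S) r v X → SrkLe r (splitter-budget t (suc ℓ) κ) ℓ (induced (delete G S) X)
  balls′ v X X-ball = srk-mono ℓ (m≤n+m _ _)
    (srk-from-frk r ℓ (κ * κ) (Ktt-free-Embedding E Ktt-free)
      (frk-embedding ℓ E′ (frk-flip ℓ (part ∘ emb Y) F (balls _ Y Y-ball))))
    where
    Y : Subset (n G)
    Y = proj₁ (ball H (3× r) (emb (∁ S) v))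
    Y-ball : IsBall H (3× r) (emb (∁ S) v) Y
    Y-ball = proj₂ (ball H (3× r) (emb (∁ S) v))
    E : Embedding (induced (delete G S) X) G
    E = induced-Embedding G (∁ S) ∘ᴱ induced-Embedding (delete G S) X
    E′ : Embedding (induced (delete G S) X) (flipG (induced H Y) (part ∘ emb Y) F)
    E′ = induced-reflip G part F Y ∘ᴱ into-induced E Y (λ i → ball-inside r X-ball Y-ball (emb∈ X i))

theorem4p6 : (t : ℕ) (C : Class) (r : ℕ∞) →
    (∀ G → C G → ¬ ContainsKtt t G) →
    (FlipBreakable (3× r) C → DeletionBreakable r C) ×
    (FlipSeparable (3× r) C → DeletionSeparable r C) ×
    (FlipFlat (3× r) C → DeletionFlat r C) ×
    (BoundedFlipperRank (3× r) C → BoundedSplitterRank r C)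
theorem4p6 t C r Ktt-free =
  deletion-breakable r Ktt-free , deletion-separable r Ktt-free , deletion-flat r Ktt-free ,
  λ (κ , ℓ , frk) → splitter-budget t ℓ κ , ℓ , λ G G∈C → srk-from-frk r ℓ κ (Ktt-free G G∈C) (frk G G∈C)
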